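{- For a problem $f$, the following are equivalent: (1) there exists some $k\in\mathbb N$ such that $?f$ is $k$-guessable; (2) $?f$ is finitely guessable.
   Context: Problems are partial multivalued functions between represented spaces; $f$ is computable if it has a computable realizer, where a realizer is a partial $F:\subseteq\mathbb N^{\mathbb N}\to\mathbb N^{\mathbb N}$ mapping every name of every $x\in\operatorname{dom}(f)$ to a name of some element of $f(x)$. For a represented space $\mathbf X$, $\mathbf X_\bot=\mathbf X\cup\{\bot\}$ where $0^\omega$ names $\bot$ and $0^n1p$ names $x$ whenever $p$ names $x\in\mathbf X$ (so an input may remain unspecified forever, or become specified at some finite stage). For $f:\subseteq\mathbf X\rightrightarrows\mathbf Y$, the problem $?f:\subseteq\mathbf X_\bot\rightrightarrows\mathbf Y$ has domain $\operatorname{dom}(f)\cup\{\bot\}$, with $?f(x)=f(x)$ for $x\in\operatorname{dom}(f)$ and $?f(\bot)=\mathbf Y$. The completion $\overline{\mathbf Y}$ of a represented space $\mathbf Y$ is $\mathbf Y\cup\{\bot\}$, where $p\in\mathbb N^{\mathbb N}$ is decoded by deleting all $0$s and subtracting $1$ from the remaining entries; if the result is an infinite sequence naming $y\in\mathbf Y$, then $p$ names $y$, otherwise $p$ names $\bot$. $\overline{\mathbf Y}^*=\bigsqcup_{\ell}\overline{\mathbf Y}^\ell$ (a name gives the length first, then a name of the tuple). For a problem $h:\subseteq\mathbf Z\rightrightarrows\mathbf Y$, let $\breve h_k:\subseteq\mathbf Z\rightrightarrows\overline{\mathbf Y}^k$ and $\breve h_*:\subseteq\mathbf Z\rightrightarrows\overline{\mathbf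 Y}^*$ be the problems with domain $\operatorname{dom}(h)$ in which a tuple $(y_0,\dots,y_\ell)$ is a solution for $z$ iff $y_i\in h(z)$ for some $i$. $h$ is $k$-guessable if $\breve h_k$ is computable, and finitely guessable if $\breve h_*$ is computable. -}

module Defs where

open import Data.Nat using (ℕ; zero; suc; _+_; _*_; _<_)
open import Data.Fin using (Fin; toℕ)
open import Data.Vec using (Vec; []; _∷_; lookup)
open import Data.Vec.Relation.Unary.Any using (Any)
open import Data.Maybe using (Maybe; just; nothing)
open import Data.Product using (Σ; _×_; _,_; ∃)
open import Data.Unit using (⊤)
open import Relation.Binary.PropositionalEquality using (_≡_)
open import Relation.Nullary using (¬_)
open import Function.Bundles using (_⇔_)

Baire : Set
Baire = ℕ → ℕ

data PR : ℕ → Set where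
  zer  : ∀ {n} → PR n
  sc   : PR 1
  proj : ∀ {n} → Fin n → PR n
  orc  : PR 1
  comp : ∀ {n m} → PR m → Vec (PR n) m → PR n
  prec : ∀ {n} → PR n → PR (suc (suc n)) → PR (suc n)
  mu   : ∀ {n} → PR (suc n) → PR n

mutual
  data Eval (p : Baire) : ∀ {n} → PR n → Vec ℕ n → ℕ → Set where
    e-zer  : ∀ {n} {xs : Vec ℕ n} → Eval p zer xs 0
    e-sc   : ∀ {x} → Eval p sc (x ∷ []) (suc x)
    e-proj : ∀ {n} {i : Fin n} {xs} → Eval p (proj i) xs (lookup xs i)
    e-orc  : ∀ {x} → Eval p orc (x ∷ []) (p x)
    e-comp : ∀ {n m} {f : PR m} {gs : Vec (PR n) m} {xs ys v} →
             EvalAll p gs xs ys → Eval p f ys v → Eval p (comp f gs) xs v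
    e-prec0 : ∀ {n} {g : PR n} {h} {xs v} →
              Eval p g xs v → Eval p (prec g h) (0 ∷ xs) v
    e-precS : ∀ {n} {g : PR n} {h} {xs y u v} →
              Eval p (prec g h) (y ∷ xs) u → Eval p h (y ∷ u ∷ xs) v →
              Eval p (prec g h) (suc y ∷ xs) v
    e-mu   : ∀ {n} {f : PR (suc n)} {xs y} →
             Eval p f (y ∷ xs) 0 →
             (∀ z → z < y → Σ ℕ λ v → Eval p f (z ∷ xs) (suc v)) →
             Eval p (mu f) xs y

  data EvalAll (p : Baire) {n : ℕ} : ∀ {m} → Vec (PR n) m → Vec ℕ n → Vec ℕ m → Set where
    []  : ∀ {xs} → EvalAll p [] xs []
    _∷_ : ∀ {m} {g : PR n} {gs : Vec (PR n) m} {xs v vs} →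
          Eval p g xs v → EvalAll p gs xs vs → EvalAll p (g ∷ gs) xs (v ∷ vs)

record RepSpace : Set₁ where
  field
    Carrier : Set
    Name    : Baire → Carrier → Set
open RepSpace public

-- the laws of a representation: partial surjection ℕ^ℕ → X, on functions
record IsRep (X : RepSpace) : Set where
  field
    ext    : ∀ {p q x} → (∀ n → p n ≡ q n) → Name X p x → Name X q x
    single : ∀ {p x y} → Name X p x → Name X p y → x ≡ y
    surj   : ∀ x → ∃ λ p → Name X p x

-- problems: partial multivalued functions
record Problem (X Y : RepSpace) : Set₁ where
  field
    Dom : Carrier X → Set
    Sol : Carrier X → Carrier Y → Set
open Problem public

Computable : {X Y : RepSpace} → Problem X Y → Set
Computable {X} {Y} f =
  Σ (PR 1) λ e → ∀ p x → Name X p x → Dom f x →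
    Σ Baire λ q → (∀ n → Eval p e (n ∷ []) (q n)) ×
      Σ (Carrier Y) λ y → Sol f x y × Name Y q y

shift : ℕ → Baire → Baire
shift n p i = p (n + i)

_⊥' : RepSpace → RepSpace
X ⊥' = record
  { Carrier = Maybe (Carrier X)
  ; Name = λ { p nothing → ∀ n → p n ≡ 0
             ; p (just x) → Σ ℕ λ n → (∀ i → i < n → p i ≡ 0) × p n ≡ 1 ×
                              Name X (shift (suc n) p) x } }

¿_ : {X Y : RepSpace} → Problem X Y → Problem (X ⊥') Y
¿ f = record
  { Dom = λ { nothing → ⊤ ; (just x) → Dom f x }
  ; Sol = λ { nothing y → ⊤ ; (just x) y → Sol f x y } }

countNZ : Baire → ℕ → ℕ
countNZ p zero = zero
countNZ p (suc i) with p i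
... | zero  = countNZ p i
... | suc _ = suc (countNZ p i)

-- d is the (infinite) result of deleting all 0s from p and subtracting 1
Decodes : Baire → Baire → Set
Decodes p d = ∀ n → Σ ℕ λ i → countNZ p i ≡ n × p i ≡ suc (d n)

completion : RepSpace → RepSpace
completion Y = record
  { Carrier = Maybe (Carrier Y)
  ; Name = λ { p (just y) → Σ Baire λ d → Decodes p d × Name Y d y
             ; p nothing → ¬ (Σ Baire λ d → Decodes p d × Σ (Carrier Y) λ y → Name Y d y) } }

TupleName : (Y : RepSpace) (k : ℕ) → Baire → Vec (Carrier Y) k → Set
TupleName Y k p ys = ∀ (i : Fin k) → Name Y (λ n → p (n * k + toℕ i)) (lookup ys i)

_^_ : RepSpace → ℕ → RepSpace
Y ^ k = record { Carrier = Vec (Carrier Y) k ; Name = TupleName Y k }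

_^* : RepSpace → RepSpace
Y ^* = record
  { Carrier = Σ ℕ λ k → Vec (Carrier Y) k
  ; Name = λ { p (k , ys) → p 0 ≡ k × TupleName Y k (shift 1 p) ys } }

HitsSolution : {Z Y : RepSpace} → Problem Z Y → Carrier Z → ∀ {k} → Vec (Maybe (Carrier Y)) k → Set
HitsSolution {Z} {Y} h z ys = Any (λ m → Σ (Carrier Y) λ y → m ≡ just y × Sol h z y) ys

breve : {Z Y : RepSpace} → Problem Z Y → (k : ℕ) → Problem Z (completion Y ^ k)
breve h k = record { Dom = Dom h ; Sol = λ z ys → HitsSolution h z ys }

breve* : {Z Y : RepSpace} → Problem Z Y → Problem Z (completion Y ^*)
breve* h = record { Dom = Dom h ; Sol = λ { z (k , ys) → HitsSolution h z ys } }

Guessable : {Z Y : RepSpace} → ℕ → Problem Z Y → Set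
Guessable k h = Computable (breve h k)

FinitelyGuessable : {Z Y : RepSpace} → Problem Z Y → Set
FinitelyGuessable h = Computable (breve* h)

{-# OPTIONS --safe #-}
module Submission where

-- A finite guesser for ?f must announce the number k of its guesses as its first
-- output.  On the name 0^ω of ⊥ it does so after reading only N entries of its input.
-- Prefixing any name of a point of X_⊥ with N zeros yields another name of the same
-- point, which agrees with 0^ω below N; so on padded inputs the guesser always
-- announces the same k, and padding followed by dropping the first output is a
-- k-guesser.  Conversely a k-guesser becomes a finite guesser by announcing k first.

open import Defs
open import Data.Nat using (ℕ; zero; suc; _+_; _<_; _≤_; _⊔_; s≤s)
open import Data.Nat.Properties
  using (m≤m⊔n; m≤n⊔m; <-≤-trans; n<1+n; m<n⇒m<1+n; m<1+n⇒m<n∨m≡n; <-cmp; +-suc; +-assoc)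
open import Data.Product using (∃; Σ; _,_; _×_)
open import Data.Sum using (inj₁; inj₂)
open import Data.Vec using (Vec; []; _∷_)
open import Data.Fin using (zero)
open import Data.Maybe using (just; nothing)
open import Data.Unit using (tt)
open import Data.Empty using (⊥-elim)
open import Relation.Nullary using (¬_)
open import Relation.Binary using (tri<; tri≈; tri>)
open import Relation.Binary.PropositionalEquality using (_≡_; refl; sym; trans; cong; subst; module ≡-Reasoning)
open ≡-Reasoning
open import Function.Bundles using (_⇔_; mk⇔)
open import Function.Base using (_∘_)

Computes : Baire → PR 1 → Baire → Set
Computes p e q = ∀ n → Eval p e (n ∷ []) (q n)

common-bound : {P : ℕ → ℕ → Set} → (∀ {z M N} → M ≤ N → P z M → P z N) →
  ∀ y → (∀ z → z < y → ∃ (P z)) → ∃ λ N → ∀ z → z < y → P z N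
common-bound mono zero bounds = 0 , λ _ ()
common-bound {P} mono (suc y) bounds
  with bounds y (n<1+n y) | common-bound mono y (λ z z<y → bounds z (m<n⇒m<1+n z<y))
... | (M , Py) | (N , Pbelow) = M ⊔ N , below
  where
  below : ∀ z → z < suc y → P z (M ⊔ N)
  below z z<1+y with m<1+n⇒m<n∨m≡n z<1+y
  ... | inj₁ z<y  = mono (m≤n⊔m M N) (Pbelow z z<y)
  ... | inj₂ refl = mono (m≤m⊔n M N) Py

AgreeBelow : ℕ → Baire → Baire → Set
AgreeBelow N p p' = ∀ i → i < N → p' i ≡ p i

agreeBelow-mono : ∀ {M N p p'} → M ≤ N → AgreeBelow N p p' → AgreeBelow M p p'
agreeBelow-mono M≤N agree i i<M = agree i (<-≤-trans i<M M≤N)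

agreeBelow-⊔ˡ : ∀ {M N p p'} → AgreeBelow (M ⊔ N) p p' → AgreeBelow M p p'
agreeBelow-⊔ˡ {M} {N} = agreeBelow-mono (m≤m⊔n M N)

agreeBelow-⊔ʳ : ∀ {M N p p'} → AgreeBelow (M ⊔ N) p p' → AgreeBelow N p p'
agreeBelow-⊔ʳ {M} {N} = agreeBelow-mono (m≤n⊔m M N)

DeterminedBelow : ℕ → Baire → ∀ {n} → PR n → Vec ℕ n → ℕ → Set
DeterminedBelow N p e xs v = ∀ p' → AgreeBelow N p p' → Eval p' e xs v

DeterminedBelowAll : ℕ → Baire → ∀ {n m} → Vec (PR n) m → Vec ℕ n → Vec ℕ m → Set
DeterminedBelowAll N p es xs vs = ∀ p' → AgreeBelow N p p' → EvalAll p' es xs vs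

determinedBelow-mono : ∀ {M N p n} {e : PR n} {xs v} →
  M ≤ N → DeterminedBelow M p e xs v → DeterminedBelow N p e xs v
determinedBelow-mono M≤N det p' agree = det p' (agreeBelow-mono M≤N agree)

mutual
  eval-use : ∀ {p n} {e : PR n} {xs v} → Eval p e xs v → ∃ λ N → DeterminedBelow N p e xs v
  eval-use e-zer  = 0 , λ _ _ → e-zer
  eval-use e-sc   = 0 , λ _ _ → e-sc
  eval-use e-proj = 0 , λ _ _ → e-proj
  eval-use (e-orc {x}) = suc x , λ p' agree → subst (Eval p' orc (x ∷ [])) (agree x (n<1+n x)) e-orc
  eval-use (e-comp args body) with evalAll-use args | eval-use body
  ... | (M , dargs) | (N , dbody) = M ⊔ N , λ p' agree →
    e-comp (dargs p' (agreeBelow-⊔ˡ agree)) (dbody p' (agreeBelow-⊔ʳ agree))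
  eval-use (e-prec0 base) with eval-use base
  ... | (N , dbase) = N , λ p' agree → e-prec0 (dbase p' agree)
  eval-use (e-precS prev step) with eval-use prev | eval-use step
  ... | (M , dprev) | (N , dstep) = M ⊔ N , λ p' agree →
    e-precS (dprev p' (agreeBelow-⊔ˡ agree)) (dstep p' (agreeBelow-⊔ʳ agree))
  eval-use (e-mu {y = y} zero-at-y nonzero-below)
    with eval-use zero-at-y
       | common-bound (λ { M≤N (v , d) → v , determinedBelow-mono M≤N d }) y
                      (λ z z<y → nonzero-use (nonzero-below z z<y))
  ... | (M , dzero) | (N , dnonzero) = M ⊔ N , λ p' agree →
    e-mu (dzero p' (agreeBelow-⊔ˡ agree))
         (λ z z<y → let (v , d) = dnonzero z z<y in v , d p' (agreeBelow-⊔ʳ agree))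

  nonzero-use : ∀ {p n} {e : PR n} {xs} → (Σ ℕ λ v → Eval p e xs (suc v)) →
    ∃ λ N → Σ ℕ λ v → DeterminedBelow N p e xs (suc v)
  nonzero-use (v , d) with eval-use d
  ... | (N , dd) = N , v , dd

  evalAll-use : ∀ {p n m} {es : Vec (PR n) m} {xs vs} → EvalAll p es xs vs →
    ∃ λ N → DeterminedBelowAll N p es xs vs
  evalAll-use [] = 0 , λ _ _ → []
  evalAll-use (d ∷ ds) with eval-use d | evalAll-use ds
  ... | (M , dd) | (N , dds) = M ⊔ N , λ p' agree →
    dd p' (agreeBelow-⊔ˡ agree) ∷ dds p' (agreeBelow-⊔ʳ agree)

mutual
  eval-det : ∀ {p n} {e : PR n} {xs v w} → Eval p e xs v → Eval p e xs w → v ≡ w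
  eval-det e-zer e-zer   = refl
  eval-det e-sc e-sc     = refl
  eval-det e-proj e-proj = refl
  eval-det e-orc e-orc   = refl
  eval-det (e-comp args body) (e-comp args′ body′) with evalAll-det args args′
  ... | refl = eval-det body body′
  eval-det (e-prec0 base) (e-prec0 base′) = eval-det base base′
  eval-det (e-precS prev step) (e-precS prev′ step′) with eval-det prev prev′
  ... | refl = eval-det step step′
  eval-det (e-mu {y = y} zero-at-y below) (e-mu {y = y′} zero-at-y′ below′) with <-cmp y y′
  ... | tri< y<y′ _ _ = ⊥-elim (eval-nonzero⇒¬zero (below′ y y<y′) zero-at-y)
  ... | tri≈ _ y≡y′ _ = y≡y′
  ... | tri> _ _ y′<y = ⊥-elim (eval-nonzero⇒¬zero (below y′ y′<y) zero-at-y′)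

  eval-nonzero⇒¬zero : ∀ {p n} {e : PR n} {xs} → (Σ ℕ λ v → Eval p e xs (suc v)) → ¬ Eval p e xs 0
  eval-nonzero⇒¬zero (v , nonzero) vanishes with eval-det nonzero vanishes
  ... | ()

  evalAll-det : ∀ {p n m} {es : Vec (PR n) m} {xs vs ws} → EvalAll p es xs vs → EvalAll p es xs ws → vs ≡ ws
  evalAll-det [] [] = refl
  evalAll-det (d ∷ ds) (d′ ∷ ds′) with eval-det d d′ | evalAll-det ds ds′
  ... | refl | refl = refl

mutual
  substOracle : ∀ {n} → PR 1 → PR n → PR n
  substOracle g zer         = zer
  substOracle g sc          = sc
  substOracle g (proj i)    = proj i
  substOracle g orc         = g
  substOracle g (comp e es) = comp (substOracle g e) (substOracleAll g es)
  substOracle g (prec e h)  = prec (substOracle g e) (substOracle g h)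
  substOracle g (mu e)      = mu (substOracle g e)

  substOracleAll : ∀ {n m} → PR 1 → Vec (PR n) m → Vec (PR n) m
  substOracleAll g []       = []
  substOracleAll g (e ∷ es) = substOracle g e ∷ substOracleAll g es

mutual
  eval-substOracle : ∀ {p p' n} {g : PR 1} {e : PR n} {xs v} →
    Computes p g p' → Eval p' e xs v → Eval p (substOracle g e) xs v
  eval-substOracle g↦p' e-zer               = e-zer
  eval-substOracle g↦p' e-sc                = e-sc
  eval-substOracle g↦p' e-proj              = e-proj
  eval-substOracle g↦p' (e-orc {x})         = g↦p' x
  eval-substOracle g↦p' (e-comp args body)  =
    e-comp (evalAll-substOracle g↦p' args) (eval-substOracle g↦p' body)
  eval-substOracle g↦p' (e-prec0 base)      = e-prec0 (eval-substOracle g↦p' base)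
  eval-substOracle g↦p' (e-precS prev step) =
    e-precS (eval-substOracle g↦p' prev) (eval-substOracle g↦p' step)
  eval-substOracle g↦p' (e-mu zero-at-y below) =
    e-mu (eval-substOracle g↦p' zero-at-y) (λ z z<y → nonzero-substOracle g↦p' (below z z<y))

  nonzero-substOracle : ∀ {p p' n} {g : PR 1} {e : PR n} {xs} → Computes p g p' →
    (Σ ℕ λ v → Eval p' e xs (suc v)) → Σ ℕ λ v → Eval p (substOracle g e) xs (suc v)
  nonzero-substOracle g↦p' (v , d) = v , eval-substOracle g↦p' d

  evalAll-substOracle : ∀ {p p' n m} {g : PR 1} {es : Vec (PR n) m} {xs vs} →
    Computes p g p' → EvalAll p' es xs vs → EvalAll p (substOracleAll g es) xs vs
  evalAll-substOracle g↦p' []       = []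
  evalAll-substOracle g↦p' (d ∷ ds) = eval-substOracle g↦p' d ∷ evalAll-substOracle g↦p' ds

padZeros : ℕ → Baire → Baire
padZeros zero    p         = p
padZeros (suc N) p zero    = 0
padZeros (suc N) p (suc i) = padZeros N p i

padZeros-below : ∀ {p} N i → i < N → padZeros N p i ≡ 0
padZeros-below (suc N) zero    _         = refl
padZeros-below (suc N) (suc i) (s≤s i<N) = padZeros-below N i i<N

padZeros-+ : ∀ {p} N j → padZeros N p (N + j) ≡ p j
padZeros-+ zero    j = refl
padZeros-+ (suc N) j = padZeros-+ N j

padZeros-zeros : ∀ {p} N → (∀ i → p i ≡ 0) → ∀ i → padZeros N p i ≡ 0
padZeros-zeros zero    zeros i       = zeros i
padZeros-zeros (suc N) zeros zero    = refl
padZeros-zeros (suc N) zeros (suc i) = padZeros-zeros N zeros i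

padZeros-leading : ∀ {p n} N → (∀ i → i < n → p i ≡ 0) → ∀ i → i < N + n → padZeros N p i ≡ 0
padZeros-leading zero    leading i       i<n         = leading i i<n
padZeros-leading (suc N) leading zero    _           = refl
padZeros-leading (suc N) leading (suc i) (s≤s i<N+n) = padZeros-leading N leading i i<N+n

padZeros-name : ∀ {X} → IsRep X → ∀ N {p x} → Name (X ⊥') p x → Name (X ⊥') (padZeros N p) x
padZeros-name R N {x = nothing} zeros = padZeros-zeros N zeros
padZeros-name R N {p} {just x} (n , leading , one , names) =
  N + n , padZeros-leading N leading , trans (padZeros-+ N n) one , IsRep.ext R same-tail names
  where
  same-tail : ∀ j → shift (suc n) p j ≡ shift (suc (N + n)) (padZeros N p) j
  same-tail j = begin
    p (suc n + j)                         ≡⟨ padZeros-+ N (suc n + j) ⟨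
    padZeros N p (N + suc (n + j))        ≡⟨ cong (padZeros N p) (+-suc N (n + j)) ⟩
    padZeros N p (suc (N + (n + j)))      ≡⟨ cong (padZeros N p ∘ suc) (+-assoc N n j) ⟨
    padZeros N p (suc (N + n + j))        ∎

padZerosProg : ℕ → PR 1
padZerosProg zero    = orc
padZerosProg (suc N) = prec zer (comp (padZerosProg N) (proj zero ∷ []))

padZerosProg-computes : ∀ {p} N → Computes p (padZerosProg N) (padZeros N p)
padZerosProg-computes zero    i       = e-orc
padZerosProg-computes (suc N) zero    = e-prec0 e-zer
padZerosProg-computes (suc N) (suc i) =
  e-precS (padZerosProg-computes (suc N) i) (e-comp (e-proj ∷ []) (padZerosProg-computes N i))

constProg : ℕ → PR 0
constProg zero    = zer
constProg (suc k) = comp sc (constProg k ∷ [])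

constProg-eval : ∀ {p} k → Eval p (constProg k) [] k
constProg-eval zero    = e-zer
constProg-eval (suc k) = e-comp (constProg-eval k ∷ []) e-sc

prepend : ℕ → Baire → Baire
prepend k q zero    = k
prepend k q (suc n) = q n

prependProg : ℕ → PR 1 → PR 1
prependProg k e = prec (constProg k) (comp e (proj zero ∷ []))

prependProg-computes : ∀ {p e q} k → Computes p e q → Computes p (prependProg k e) (prepend k q)
prependProg-computes k e↦q zero    = e-prec0 (constProg-eval k)
prependProg-computes k e↦q (suc n) =
  e-precS (prependProg-computes k e↦q n) (e-comp (e-proj ∷ []) (e↦q n))

dropProg : PR 1 → PR 1
dropProg e = comp e (comp sc (proj zero ∷ []) ∷ [])

dropProg-computes : ∀ {p e q} → Computes p e q → Computes p (dropProg e) (shift 1 q)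
dropProg-computes e↦q n = e-comp (e-comp (e-proj ∷ []) e-sc ∷ []) (e↦q (suc n))

Realizes : {X Y : RepSpace} → PR 1 → Problem X Y → Set
Realizes {X} {Y} e f = ∀ p x → Name X p x → Dom f x →
  Σ Baire λ q → Computes p e q × Σ (Carrier Y) λ y → Sol f x y × Name Y q y

guessable⇒finitelyGuessable : ∀ {Z Y} (h : Problem Z Y) k → Guessable k h → FinitelyGuessable h
guessable⇒finitelyGuessable h k (e , realize) = prependProg k e , realize*
  where
  realize* : Realizes (prependProg k e) (breve* h)
  realize* p z names dom with realize p z names dom
  ... | (q , e↦q , ys , hits , names-ys) =
    prepend k q , prependProg-computes k e↦q , (k , ys) , hits , refl , names-ys

finitelyGuessable⇒guessable : ∀ {X Y} → IsRep X → (f : Problem X Y) →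
  FinitelyGuessable (¿ f) → ∃ λ k → Guessable k (¿ f)
finitelyGuessable⇒guessable R f (e , realize*) with realize* (λ _ → 0) nothing (λ _ → refl) tt
... | (q₀ , e↦q₀ , _) with eval-use (e↦q₀ 0)
... | (N , length-determined) = q₀ 0 , dropProg (substOracle (padZerosProg N) e) , realize
  where
  realize : Realizes (dropProg (substOracle (padZerosProg N) e)) (breve (¿ f) (q₀ 0))
  realize p x names dom with realize* (padZeros N p) x (padZeros-name R N names) dom
  ... | (q , e↦q , (k , ys) , hits , q0≡k , names-ys)
    with trans (sym q0≡k) (eval-det (e↦q 0) (length-determined (padZeros N p) (padZeros-below N)))
  ... | refl =
    shift 1 q , dropProg-computes (eval-substOracle (padZerosProg-computes N) ∘ e↦q) , ys , hits , names-ys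

proposition12 : (X Y : RepSpace) → IsRep X → IsRep Y → (f : Problem X Y) →
    (∃ λ (k : ℕ) → Guessable k (¿ f)) ⇔ FinitelyGuessable (¿ f)
proposition12 X Y RX _ f =
  mk⇔ (λ (k , guess) → guessable⇒finitelyGuessable (¿ f) k guess) (finitelyGuessable⇒guessable RX f)
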